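{- Let $\mathrm{For}$ be the set of formulas of the propositional language with variables $p_0,p_1,\dots$, unary connective $\neg$ and binary connectives $\wedge,\vee,\rightarrow$. For $k\in\mathbb{N}$ write $\neg^k A$ for $A$ preceded by $k$ occurrences of $\neg$ (so $\neg^0A=A$). Consider the following conditions on a binary relation $R\subseteq \mathrm{For}\times\mathrm{For}$: (GCUN) for all $k,l,m,n\in\mathbb{N}$ and all $A,B\in\mathrm{For}$: $R(\neg^kA,\neg^lB)\Rightarrow R(\neg^mA,\neg^nB)$; (b0) for all $A,B$: $R(A,B)\Rightarrow$ not $R(A,\neg B)$; (b1) for all $A,B$: $R(A\rightarrow B,\ \neg(A\rightarrow\neg B))$; (b2) for all $A,B$: $R(A\rightarrow \neg B,\ \neg(A\rightarrow B))$. Then the class of all relations $R\subseteq\mathrm{For}\times\mathrm{For}$ satisfying (GCUN), (b0) and (b1) is empty, and the class of all relations satisfying (GCUN), (b0) and (b2) is empty. -}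

module Defs where

open import Data.Nat using (ℕ; zero; suc)
open import Data.Product using (_×_)
open import Relation.Nullary using (¬_)

data For : Set where
  var  : ℕ → For
  neg  : For → For
  _∧′_ : For → For → For
  _∨′_ : For → For → For
  _⇒′_ : For → For → For

negs : ℕ → For → For
negs zero    A = A
negs (suc k) A = neg (negs k A)

Rel : Set₁
Rel = For → For → Set

GCUN : Rel → Set
GCUN R = ∀ (k l m n : ℕ) (A B : For) → R (negs k A) (negs l B) → R (negs m A) (negs n B)

b0 : Rel → Set
b0 R = ∀ (A B : For) → R A B → ¬ R A (neg B)

b1 : Rel → Set
b1 R = ∀ (A B : For) → R (A ⇒′ B) (neg (A ⇒′ neg B))

b2 : Rel → Set
b2 R = ∀ (A B : For) → R (A ⇒′ neg B) (neg (A ⇒′ B))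

module Submission where

open import Defs
open import Data.Product using (_×_; _,_)
open import Relation.Nullary using (¬_)

-- GCUN strips a negation from the second argument, so R A (¬ B) would yield
-- R A B, which b0 forbids; yet b1 and b2 each demand a pair of that shape.

GCUN∧b0⇒¬R-neg : (R : Rel) → GCUN R → b0 R → ∀ A B → ¬ R A (neg B)
GCUN∧b0⇒¬R-neg R gcun consistent A B rA¬B =
  consistent A B (gcun 0 1 0 0 A B rA¬B) rA¬B

mainTheorem1 : ((R : Rel) → ¬ (GCUN R × b0 R × b1 R))
    × ((R : Rel) → ¬ (GCUN R × b0 R × b2 R))
mainTheorem1 =
  (λ R → λ { (gcun , consistent , b1R) →
      GCUN∧b0⇒¬R-neg R gcun consistent _ _ (b1R (var 0) (var 1)) })
  , (λ R → λ { (gcun , consistent , b2R) →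
      GCUN∧b0⇒¬R-neg R gcun consistent _ _ (b2R (var 0) (var 1)) })
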